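{- Let $n$ and $i$ be integers, let $Y\subseteq [n]$ and let $x\in[n]$. Suppose that either $n-4\ge 1$ and $Y\in \mathcal{C}_{n-4}^{i-1}$, or $n-5\ge 1$ and $Y\in\mathcal{C}_{n-5}^{i-1}$. If $Y\cup\{x\}\in \mathcal{C}_n^i$, then $Y\in \mathcal{C}_{n-3}^{i-1}$.
   Context: For an integer $m\ge 3$, $C_m$ denotes the cycle with vertex set $[m]=\{1,2,\dots,m\}$ and edge set $\{\{1,2\},\{2,3\},\dots,\{m-1,m\},\{m,1\}\}$; by convention $C_1$ is the graph with the single vertex $1$, and $C_2$ is the graph on $\{1,2\}$ with the single edge $\{1,2\}$. A set $S$ of vertices of a graph $G$ is a dominating set if every vertex not in $S$ is adjacent to at least one vertex of $S$. For $m\ge1$ and an integer $j$, $\mathcal{C}_m^j$ denotes the family of dominating sets of $C_m$ of cardinality $j$ (so it is empty if $j<0$ or $j>m$). Subsets of $[m]$ are regarded as subsets of $[n]$ whenever $m\le n$. -}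

module Defs where

open import Data.Nat using (ℕ; zero; suc; _≤_; _<_)
open import Data.Integer using (ℤ; +_)
open import Data.Fin using (Fin; toℕ)
open import Data.Fin.Subset using (Subset; _∈_; ∣_∣)
open import Data.Product using (_×_; ∃)
open import Data.Sum using (_⊎_)
open import Relation.Binary.PropositionalEquality using (_≡_)

-- Vertices are 0-indexed: the natural number k stands for vertex k+1 of [m].
-- Adjacency in C_m (m ≥ 3: cycle; m = 2: single edge {1,2}; m = 1: no edges).
Adj : ℕ → ℕ → ℕ → Set
Adj m a b =
  (a < m × b < m × (suc a ≡ b ⊎ suc b ≡ a))
  ⊎ (3 ≤ m × ((a ≡ 0 × suc b ≡ m) ⊎ (b ≡ 0 × suc a ≡ m)))

-- A subset Y of [n] (element y : Fin n stands for vertex toℕ y + 1) lies in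
-- the family C_m^j of dominating sets of C_m of cardinality j (m ≤ n).
InC : (n m : ℕ) → ℤ → Subset n → Set
InC n m j Y =
  1 ≤ m × m ≤ n
  × (∀ (y : Fin n) → y ∈ Y → toℕ y < m)
  × (∀ (v : Fin n) → toℕ v < m →
       v ∈ Y ⊎ ∃ (λ (u : Fin n) → u ∈ Y × Adj m (toℕ u) (toℕ v)))
  × (+ ∣ Y ∣ ≡ j)

-- If Y lies in [n-4] and Y ∪ {x} dominates C_n, then the vertices n-2 and n-1 (1-indexed) can only be
-- dominated by x, which forces x ∈ {n-2, n-1}; so x dominates none of 1, …, n-5 and these are dominated
-- by Y along path edges that C_{n-3} also has. The last vertex n-4 of C_{n-3} is dominated by Y in C_n:
-- through n-5 if x = n-1, and otherwise through vertex 1, since x = n-2 then misses vertex n, whose only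
-- other neighbour is 1 — and 1 is adjacent to n-4 in C_{n-3} as well.
module Submission where

open import Defs
open import Data.Nat using (ℕ; zero; suc; _+_; _∸_; _≤_; _<_; _≤?_; z≤n; s≤s; s≤s⁻¹)
open import Data.Nat.Properties
  using (≤-refl; ≤-trans; ≤-antisym; <⇒≤; <-irrefl; n≤1+n; m≤n+m; m≤n⇒m<n∨m≡n;
         m<n⇒n≢0; m∸n≢0⇒n<m; m≤n⇒∃[o]m+o≡n)
open import Data.Integer using (ℤ; _-_; +_)
open import Data.Fin using (Fin; toℕ; fromℕ<)
open import Data.Fin.Properties using (toℕ-fromℕ<; toℕ-injective)
open import Data.Fin.Subset using (Subset; _∪_; ⁅_⁆; _∈_; ∣_∣)
open import Data.Fin.Subset.Properties using (x∈p∪q⁻; x∈⁅y⁆⇒x≡y)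
open import Data.Product using (_×_; _,_; ∃; proj₁; proj₂)
open import Data.Sum using (_⊎_; inj₁; inj₂; [_,_]′)
open import Data.Empty using (⊥-elim)
open import Relation.Nullary using (yes; no)
open import Relation.Binary.PropositionalEquality using (_≡_; refl; sym; subst)

Dominates : ℕ → ℕ → ℕ → Set
Dominates m u v = u ≡ v ⊎ Adj m u v

DominatedBy : ℕ → {n : ℕ} → Subset n → ℕ → Set
DominatedBy m Y v = ∃ λ u → u ∈ Y × Dominates m (toℕ u) v

Adj-sym : ∀ {m a b} → Adj m a b → Adj m b a
Adj-sym (inj₁ (a<m , b<m , inj₁ e)) = inj₁ (b<m , a<m , inj₂ e)
Adj-sym (inj₁ (a<m , b<m , inj₂ e)) = inj₁ (b<m , a<m , inj₁ e)
Adj-sym (inj₂ (3≤m , inj₁ e)) = inj₂ (3≤m , inj₂ e)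
Adj-sym (inj₂ (3≤m , inj₂ e)) = inj₂ (3≤m , inj₁ e)

Dominates-sym : ∀ {m a b} → Dominates m a b → Dominates m b a
Dominates-sym (inj₁ e) = inj₁ (sym e)
Dominates-sym (inj₂ a) = inj₂ (Adj-sym a)

Adj-step : ∀ {m a} → suc a < m → Adj m a (suc a)
Adj-step 1+a<m = inj₁ (<⇒≤ 1+a<m , 1+a<m , inj₁ refl)

Adj-first-last : ∀ k → Adj (2 + k) 0 (suc k)
Adj-first-last zero = Adj-step ≤-refl
Adj-first-last (suc k) = inj₂ (s≤s (s≤s (s≤s z≤n)) , inj₁ (refl , refl))

Adj-interior : ∀ {m a b} → 0 < b → suc b < m → Adj m a b → suc a ≡ b ⊎ suc b ≡ a
Adj-interior _ _ (inj₁ (_ , _ , e)) = e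
Adj-interior _ 1+b<m (inj₂ (_ , inj₁ (_ , refl))) = ⊥-elim (<-irrefl refl 1+b<m)
Adj-interior () _ (inj₂ (_ , inj₂ (refl , _)))

Dominates-interior : ∀ {m a b} → 0 < b → suc b < m → Dominates m a b → b ≤ suc a × a ≤ suc b
Dominates-interior _ _ (inj₁ refl) = n≤1+n _ , n≤1+n _
Dominates-interior 0<b 1+b<m (inj₂ adj) with Adj-interior 0<b 1+b<m adj
... | inj₁ refl = ≤-refl , ≤-trans (n≤1+n _) (n≤1+n _)
... | inj₂ refl = ≤-trans (n≤1+n _) (n≤1+n _) , ≤-refl

Dominates-last : ∀ {m a b} → suc b ≡ m → suc a < b → Dominates m a b → a ≡ 0
Dominates-last _ 1+a<a (inj₁ refl) = ⊥-elim (<-irrefl refl (≤-trans (n≤1+n _) 1+a<a))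
Dominates-last _ 1+a<b (inj₂ (inj₁ (_ , _ , inj₁ refl))) = ⊥-elim (<-irrefl refl 1+a<b)
Dominates-last _ 1+a<b (inj₂ (inj₁ (_ , _ , inj₂ refl))) =
  ⊥-elim (<-irrefl refl (≤-trans (n≤1+n _) (≤-trans 1+a<b (n≤1+n _))))
Dominates-last _ _ (inj₂ (inj₂ (_ , inj₁ (a≡0 , _)))) = a≡0
Dominates-last _ () (inj₂ (inj₂ (_ , inj₂ (refl , _))))

-- Away from the vertex m-1 that closes the cycle, adjacency in C_m is path adjacency.
Dominates-restrict : ∀ {m k a b} → suc a < m → suc b < m → a < k → b < k →
                     Dominates m a b → Dominates k a b
Dominates-restrict _ _ _ _ (inj₁ e) = inj₁ e
Dominates-restrict _ _ a<k b<k (inj₂ (inj₁ (_ , _ , e))) = inj₂ (inj₁ (a<k , b<k , e))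
Dominates-restrict _ 1+b<m _ _ (inj₂ (inj₂ (_ , inj₁ (_ , refl)))) = ⊥-elim (<-irrefl refl 1+b<m)
Dominates-restrict 1+a<m _ _ _ (inj₂ (inj₂ (_ , inj₂ (_ , refl)))) = ⊥-elim (<-irrefl refl 1+a<m)

module _ {n m : ℕ} where

  InC⇒dominated : ∀ {j} {Z : Subset n} → InC n m j Z → ∀ k → k < m → DominatedBy m Z k
  InC⇒dominated (_ , m≤n , _ , dom , _) k k<m
    with dom (fromℕ< (≤-trans k<m m≤n)) (subst (_< m) (sym (toℕ-fromℕ< _)) k<m)
  ... | inj₁ v∈Z = _ , v∈Z , inj₁ (toℕ-fromℕ< _)
  ... | inj₂ (u , u∈Z , adj) = u , u∈Z , inj₂ (subst (Adj m (toℕ u)) (toℕ-fromℕ< _) adj)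

  dominated-∪-⁅⁆ : ∀ {Y : Subset n} {x k} → DominatedBy m (Y ∪ ⁅ x ⁆) k →
                   DominatedBy m Y k ⊎ Dominates m (toℕ x) k
  dominated-∪-⁅⁆ {Y} {x} (u , u∈Y∪x , d) with x∈p∪q⁻ Y ⁅ x ⁆ u∈Y∪x
  ... | inj₁ u∈Y = inj₁ (u , u∈Y , d)
  ... | inj₂ u∈x = inj₂ (subst (λ w → Dominates m (toℕ w) _) (x∈⁅y⁆⇒x≡y x u∈x) d)

  dominated⇒InC-dom : ∀ {Y : Subset n} (v : Fin n) → DominatedBy m Y (toℕ v) →
                      v ∈ Y ⊎ ∃ (λ u → u ∈ Y × Adj m (toℕ u) (toℕ v))
  dominated⇒InC-dom v (u , u∈Y , inj₁ e) = inj₁ (subst (_∈ _) (toℕ-injective e) u∈Y)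
  dominated⇒InC-dom v (u , u∈Y , inj₂ adj) = inj₂ (u , u∈Y , adj)

module ShorterCycle {n m : ℕ} {Y : Subset n} {x : ℕ} (Y≤m : ∀ y → y ∈ Y → toℕ y ≤ m)
  (dom : ∀ k → k < 5 + m → DominatedBy (5 + m) Y k ⊎ Dominates (5 + m) x k) where

  Y≤k+m : ∀ k {y} → y ∈ Y → toℕ y ≤ k + m
  Y≤k+m k y∈Y = ≤-trans (Y≤m _ y∈Y) (m≤n+m m k)

  dominated-by-x : ∀ k → 2 + m ≤ k → suc k < 5 + m → Dominates (5 + m) x k
  dominated-by-x k 2+m≤k 1+k<5+m with dom k (≤-trans (n≤1+n _) 1+k<5+m)
  ... | inj₂ d = d
  ... | inj₁ (u , u∈Y , d) =
    ⊥-elim (<-irrefl refl (≤-trans 2+m≤k (≤-trans k≤1+u (s≤s (Y≤m u u∈Y)))))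
    where
    k≤1+u : k ≤ suc (toℕ u)
    k≤1+u = proj₁ (Dominates-interior (≤-trans (s≤s z≤n) 2+m≤k) 1+k<5+m d)

  x-range : 2 + m ≤ x × x ≤ 3 + m
  x-range = s≤s⁻¹ (proj₁ (Dominates-interior (s≤s z≤n) ≤-refl
                                             (dominated-by-x (3 + m) (n≤1+n _) ≤-refl)))
          , proj₂ (Dominates-interior (s≤s z≤n) (s≤s (n≤1+n _))
                                      (dominated-by-x (2 + m) ≤-refl (s≤s (n≤1+n _))))

  x-reach : ∀ {k} → Dominates (5 + m) x k → x ≤ suc k × k ≤ suc x
  x-reach d = Dominates-interior (≤-trans (s≤s z≤n) (proj₁ x-range)) (s≤s (s≤s (proj₂ x-range)))
                                 (Dominates-sym d)

  last-dominated : DominatedBy (2 + m) Y (suc m)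
  last-dominated with x ≤? 2 + m
  ... | yes x≤2+m with dom (4 + m) ≤-refl
  ...   | inj₂ d = ⊥-elim (<-irrefl refl (≤-trans (proj₂ (x-reach d)) (s≤s x≤2+m)))
  ...   | inj₁ (u , u∈Y , d) =
          u , u∈Y , inj₂ (subst (λ w → Adj (2 + m) w (suc m)) (sym u≡0) (Adj-first-last m))
    where
    u≡0 : toℕ u ≡ 0
    u≡0 = Dominates-last refl (s≤s (s≤s (Y≤k+m 2 u∈Y))) d
  last-dominated | no x≰2+m with dom (suc m) (s≤s (s≤s (m≤n+m m 3)))
  ...   | inj₂ d = ⊥-elim (x≰2+m (proj₁ (x-reach d)))
  ...   | inj₁ (u , u∈Y , d) =
          u , u∈Y , inj₂ (subst (λ w → Adj (2 + m) w (suc m)) (sym u≡m) (Adj-step ≤-refl))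
    where
    u≡m : toℕ u ≡ m
    u≡m = ≤-antisym (Y≤m u u∈Y)
                    (s≤s⁻¹ (proj₁ (Dominates-interior (s≤s z≤n) (s≤s (s≤s (s≤s (m≤n+m m 2)))) d)))

  dominated-in-C-2+m : ∀ k → k < 2 + m → DominatedBy (2 + m) Y k
  dominated-in-C-2+m k k<2+m with m≤n⇒m<n∨m≡n (s≤s⁻¹ k<2+m)
  ... | inj₂ refl = last-dominated
  ... | inj₁ k<1+m with dom k (≤-trans k<2+m (m≤n+m (2 + m) 3))
  ...   | inj₂ d = ⊥-elim (<-irrefl refl (≤-trans (proj₁ x-range) (≤-trans (proj₁ (x-reach d)) k<1+m)))
  ...   | inj₁ (u , u∈Y , d) =
          u , u∈Y , Dominates-restrict (s≤s (s≤s (Y≤k+m 3 u∈Y))) (s≤s (≤-trans k<1+m (m≤n+m (suc m) 3)))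
                                       (s≤s (Y≤k+m 1 u∈Y)) k<2+m d

InC-drop-three : ∀ {m i j} {Y : Subset (5 + m)} {x : Fin (5 + m)} →
                 (∀ y → y ∈ Y → toℕ y ≤ m) → + ∣ Y ∣ ≡ j →
                 InC (5 + m) (5 + m) i (Y ∪ ⁅ x ⁆) → InC (5 + m) (2 + m) j Y
InC-drop-three {m} Y≤m card dom =
  s≤s z≤n , s≤s (s≤s (m≤n+m m 3)) , (λ y y∈Y → s≤s (≤-trans (Y≤m y y∈Y) (n≤1+n _)))
  , (λ v v<2+m → dominated⇒InC-dom v (dominated-in-C-2+m (toℕ v) v<2+m)) , card
  where open ShorterCycle Y≤m (λ k k<5+m → dominated-∪-⁅⁆ (InC⇒dominated dom k k<5+m))

positive-∸⇒< : ∀ {n k} → 1 ≤ n ∸ k → k < n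
positive-∸⇒< 1≤n∸k = m∸n≢0⇒n<m (m<n⇒n≢0 1≤n∸k)

lemma2 : (n : ℕ) (i : ℤ) (Y : Subset n) (x : Fin n) →
    ((1 ≤ n ∸ 4 × InC n (n ∸ 4) (i - + 1) Y) ⊎ (1 ≤ n ∸ 5 × InC n (n ∸ 5) (i - + 1) Y)) →
    InC n n i (Y ∪ ⁅ x ⁆) →
    InC n (n ∸ 3) (i - + 1) Y
lemma2 n i Y x hyp dom with m≤n⇒∃[o]m+o≡n {m = 5} {n = n} 5≤n
  where
  5≤n : 5 ≤ n
  5≤n = [ (λ (p , _) → positive-∸⇒< p) , (λ (p , _) → <⇒≤ (positive-∸⇒< p)) ]′ hyp
... | m , refl = InC-drop-three Y≤m card dom
  where
  Y≤m : ∀ y → y ∈ Y → toℕ y ≤ m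
  Y≤m = [ (λ (_ , _ , _ , Y<1+m , _) y y∈Y → s≤s⁻¹ (Y<1+m y y∈Y))
        , (λ (_ , _ , _ , Y<m , _) y y∈Y → <⇒≤ (Y<m y y∈Y)) ]′ hyp
  card : + ∣ Y ∣ ≡ i - + 1
  card = [ (λ (_ , _ , _ , _ , _ , c) → c) , (λ (_ , _ , _ , _ , _ , c) → c) ]′ hyp
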